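{- Let $C_1,C_2$ be cycles of odd length in a graph with $|C_1|\equiv|C_2|\pmod 4$, and let $P_1,P_2,P_3$ be vertex-disjoint paths from $C_1$ to $C_2$. Then: (1) if $C_1,C_2$ are vertex-disjoint and $|P_1|+|P_2|$ is even, then $C_1\cup C_2\cup P_1\cup P_2$ contains a cycle of length divisible by $4$; (2) if $V(C_1)\cap V(C_2)=\{x\}$, $P_1$ has even length and $x\notin V(P_1)$, then $C_1\cup C_2\cup P_1$ contains a cycle of length divisible by $4$; (3) if $C_1,C_2$ are vertex-disjoint, then $C_1\cup C_2\cup P_1\cup P_2\cup P_3$ contains a cycle of length divisible by $4$.
   Context: Graphs are finite and simple; $|P|$ and $|C|$ denote numbers of edges. For subgraphs $X,Y$, a path from $X$ to $Y$ is a path with one end-vertex in $X$, the other end-vertex in $Y$, and all internal vertices outside $V(X)\cup V(Y)$. -}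

module Defs where

open import Data.Nat using (ℕ; zero; suc; _≤_; _∸_)
open import Data.Fin using (Fin)
open import Data.List using (List; []; _∷_; _++_; length)
open import Data.List.Relation.Unary.All using (All)
open import Data.List.Relation.Unary.Linked using (Linked)
open import Data.List.Relation.Unary.Unique.Propositional using (Unique)
open import Data.List.Membership.Propositional using (_∈_; _∉_)
open import Data.Sum using (_⊎_)
open import Data.Product using (_×_)
open import Data.Empty using (⊥)
open import Relation.Nullary using (¬_)

record Graph (n : ℕ) : Set₁ where
  field
    Adj    : Fin n → Fin n → Set
    sym    : ∀ {u v} → Adj u v → Adj v u
    irrefl : ∀ {v} → ¬ Adj v v

lastOf : ∀ {A : Set} → A → List A → A
lastOf x []       = x
lastOf x (y ∷ ys) = lastOf y ys

dropLast : ∀ {A : Set} → List A → List A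
dropLast []           = []
dropLast (x ∷ [])     = []
dropLast (x ∷ y ∷ ys) = x ∷ dropLast (y ∷ ys)

data Consec {A : Set} : List A → A → A → Set where
  here  : ∀ {x y zs} → Consec (x ∷ y ∷ zs) x y
  there : ∀ {x ys u w} → Consec ys u w → Consec (x ∷ ys) u w

WalkEdge : ∀ {A : Set} → List A → A → A → Set
WalkEdge xs u w = Consec xs u w ⊎ Consec xs w u

-- Paths: vertex sequence first ∷ rest, distinct vertices, consecutive
-- vertices adjacent.  |P| = number of edges = length rest.

record Path {n : ℕ} (G : Graph n) : Set where
  field
    first    : Fin n
    rest     : List (Fin n)
    distinct : Unique (first ∷ rest)
    adjacent : Linked (Graph.Adj G) (first ∷ rest)

  verts : List (Fin n)
  verts = first ∷ rest

  lastV : Fin n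
  lastV = lastOf first rest

  internal : List (Fin n)
  internal = dropLast rest

  len : ℕ
  len = length rest

  Edge : Fin n → Fin n → Set
  Edge = WalkEdge verts

-- Cycles: distinct vertices first ∷ rest (at least 3 of them), consecutive
-- vertices adjacent and the last vertex adjacent to first.
-- |C| = number of edges = number of vertices.

record Cycle {n : ℕ} (G : Graph n) : Set where
  field
    first    : Fin n
    rest     : List (Fin n)
    long     : 2 ≤ length rest
    distinct : Unique (first ∷ rest)
    adjacent : Linked (Graph.Adj G) (first ∷ rest ++ first ∷ [])

  verts : List (Fin n)
  verts = first ∷ rest

  len : ℕ
  len = suc (length rest)

  Edge : Fin n → Fin n → Set
  Edge = WalkEdge (first ∷ rest ++ first ∷ [])

VDisjoint : ∀ {n} → List (Fin n) → List (Fin n) → Set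
VDisjoint xs ys = ∀ v → v ∈ xs → v ∈ ys → ⊥

PathFromTo : ∀ {n} {G : Graph n} → Cycle G → Cycle G → Path G → Set
PathFromTo C₁ C₂ P =
  Path.first P ∈ Cycle.verts C₁ ×
  Path.lastV P ∈ Cycle.verts C₂ ×
  All (λ v → v ∉ Cycle.verts C₁ × v ∉ Cycle.verts C₂) (Path.internal P)

-- D ⊆ H, where H is a subgraph given by its edge relation: every edge of
-- the cycle D is an edge of H (its vertices are then vertices of H).
CycleIn : ∀ {n} {G : Graph n} → Cycle G → (Fin n → Fin n → Set) → Set
CycleIn D H = ∀ u w → Cycle.Edge D u w → H u w

{-# OPTIONS --safe #-}
module Submission where

-- Two distinct vertices s, t of a cycle C cut it into two arcs from s to t with lengths
-- α₁ + α₂ = |C|.  In (1) we close up P₁, an arc of C₂, P₂ reversed and an arc of C₁; in (2)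
-- an arc of C₁ from x, P₁ and an arc of C₂ back to x.  With p the length contributed by the
-- paths, the four choices of arcs give cycles of lengths p + αᵢ + βⱼ, where α₁ + α₂ = |C₁| and
-- β₁ + β₂ = |C₂|.  If p is even and |C₁| ≡ |C₂| is odd modulo 4, one of these four numbers is
-- divisible by 4, a finite check on residues modulo 4.  Part (3) follows from (1) because two
-- of |P₁|, |P₂|, |P₃| have the same parity.

open import Defs
open import Data.Nat using (ℕ; suc; _+_; _%_; _≤_; _<_; s≤s; z≤n)
open import Data.Nat.Properties using (_≟_; allUpTo?; ≤-trans; m≤n⇒m≤1+n; +-comm; suc-injective)
open import Data.Nat.DivMod using (%-distribˡ-+; m∣n⇒o%n%m≡o%m; m%n<n)
open import Data.Nat.Divisibility using (_∣_; divides; m%n≡0⇒n∣m; n∣m⇒m%n≡0)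
open import Data.Nat.Tactic.RingSolver using (solve-∀)
open import Data.Fin using (Fin)
open import Data.List as List using (List; []; _∷_; _++_; length; [_])
open import Data.List.Properties
  using (++-assoc; reverse-++; unfold-reverse; reverse-involutive; length-++; length-reverse; length-++-≤ʳ)
import Data.List.Relation.Unary.All as All
import Data.List.Relation.Unary.All.Properties as All
open import Data.List.Relation.Unary.Any using (here; there)
open import Data.List.Relation.Unary.Any.Properties using (reverse⁻)
open import Data.List.Relation.Unary.Linked using (Linked; []; [-]; _∷_)
open import Data.List.Relation.Unary.Unique.Propositional using (Unique; []; _∷_; tail)
import Data.List.Relation.Unary.Unique.Propositional.Properties as Unique
import Data.List.Relation.Binary.Permutation.Setoid as Permutation
import Data.List.Relation.Binary.Permutation.Setoid.Properties as PermutationProperties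
open import Data.List.Relation.Binary.Disjoint.Propositional using (Disjoint)
open import Data.List.Relation.Binary.Subset.Propositional using (_⊆_)
open import Data.List.Membership.Propositional using (_∈_; _∉_)
open import Data.List.Membership.Propositional.Properties using (∈-++⁺ˡ; ∈-++⁺ʳ; ∈-++⁻; ∈-∃++)
open import Data.Sum using (_⊎_; inj₁; inj₂; [_,_]′) renaming (map to map⊎)
open import Data.Product using (_×_; _,_; proj₁; proj₂; Σ)
open import Function using (_∘_; id)
open import Level using (0ℓ)
open import Relation.Binary.Core using (Rel; _⇒_)
open import Relation.Binary.PropositionalEquality
  using (_≡_; _≢_; refl; sym; trans; cong; cong₂; subst; setoid; module ≡-Reasoning)
open import Relation.Nullary.Decidable using (_⊎-dec_; _→-dec_; toWitness)
open import Relation.Nullary.Negation using (contradiction)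

crossingSum-residues : ∀ {p} → p < 4 → ∀ {α₁} → α₁ < 4 → ∀ {α₂} → α₂ < 4 →
  ∀ {β₁} → β₁ < 4 → ∀ {β₂} → β₂ < 4 →
  p % 2 ≡ 0 → (α₁ + α₂) % 4 % 2 ≡ 1 → (α₁ + α₂) % 4 ≡ (β₁ + β₂) % 4 →
  (p + (α₁ + β₁) % 4) % 4 ≡ 0 ⊎ (p + (α₁ + β₂) % 4) % 4 ≡ 0 ⊎
  (p + (α₂ + β₁) % 4) % 4 ≡ 0 ⊎ (p + (α₂ + β₂) % 4) % 4 ≡ 0
crossingSum-residues = toWitness {a? =
  allUpTo? (λ p → allUpTo? (λ α₁ → allUpTo? (λ α₂ → allUpTo? (λ β₁ → allUpTo? (λ β₂ →
    (p % 2 ≟ 0) →-dec ((α₁ + α₂) % 4 % 2 ≟ 1) →-dec ((α₁ + α₂) % 4 ≟ (β₁ + β₂) % 4) →-dec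
    ((p + (α₁ + β₁) % 4) % 4 ≟ 0 ⊎-dec (p + (α₁ + β₂) % 4) % 4 ≟ 0 ⊎-dec
     (p + (α₂ + β₁) % 4) % 4 ≟ 0 ⊎-dec (p + (α₂ + β₂) % 4) % 4 ≟ 0)) 4) 4) 4) 4) 4} _

crossingSum : ∀ {p α₁ α₂ β₁ β₂} → 2 ∣ p → (α₁ + α₂) % 2 ≡ 1 → (α₁ + α₂) % 4 ≡ (β₁ + β₂) % 4 →
  4 ∣ p + (α₁ + β₁) ⊎ 4 ∣ p + (α₁ + β₂) ⊎ 4 ∣ p + (α₂ + β₁) ⊎ 4 ∣ p + (α₂ + β₂)
crossingSum {p} {α₁} {α₂} {β₁} {β₂} 2∣p odd same =
  map⊎ (fromResidues α₁ β₁) (map⊎ (fromResidues α₁ β₂) (map⊎ (fromResidues α₂ β₁) (fromResidues α₂ β₂)))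
    (crossingSum-residues (m%n<n p 4) (m%n<n α₁ 4) (m%n<n α₂ 4) (m%n<n β₁ 4) (m%n<n β₂ 4)
      (trans (%4%2 p) (n∣m⇒m%n≡0 p 2 2∣p))
      (trans (cong (_% 2) (+-%4 α₁ α₂)) (trans (%4%2 (α₁ + α₂)) odd))
      (trans (+-%4 α₁ α₂) (trans same (sym (+-%4 β₁ β₂)))))
  where
  %4%2 : ∀ m → m % 4 % 2 ≡ m % 2
  %4%2 m = m∣n⇒o%n%m≡o%m 2 4 m (divides 2 refl)

  +-%4 : ∀ m n → (m % 4 + n % 4) % 4 ≡ (m + n) % 4
  +-%4 m n = sym (%-distribˡ-+ m n 4)

  fromResidues : ∀ α β → (p % 4 + (α % 4 + β % 4) % 4) % 4 ≡ 0 → 4 ∣ p + (α + β)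
  fromResidues α β ≡0 = m%n≡0⇒n∣m _ 4 (begin
    (p + (α + β)) % 4                   ≡⟨ +-%4 p (α + β) ⟨
    (p % 4 + (α + β) % 4) % 4           ≡⟨ cong (λ r → (p % 4 + r) % 4) (+-%4 α β) ⟨
    (p % 4 + (α % 4 + β % 4) % 4) % 4   ≡⟨ ≡0 ⟩
    0                                   ∎)
    where open ≡-Reasoning

evenPairSum : ∀ p q r → 2 ∣ p + q ⊎ 2 ∣ p + r ⊎ 2 ∣ q + r
evenPairSum p q r =
  map⊎ (even p q) (map⊎ (even p r) (even q r))
    (toWitness {a? = allUpTo? (λ x → allUpTo? (λ y → allUpTo? (λ z →
       (x + y) % 2 ≟ 0 ⊎-dec (x + z) % 2 ≟ 0 ⊎-dec (y + z) % 2 ≟ 0) 2) 2) 2} _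
      (m%n<n p 2) (m%n<n q 2) (m%n<n r 2))
  where
  even : ∀ m n → (m % 2 + n % 2) % 2 ≡ 0 → 2 ∣ m + n
  even m n ≡0 = m%n≡0⇒n∣m _ 2 (trans (%-distribˡ-+ m n 2) ≡0)

module _ {A : Set} where

  open Permutation (setoid A) using (_↭_; ↭-sym)
  open PermutationProperties (setoid A) using (Unique-resp-↭; ↭-reverse)

  consec-cast : ∀ {xs ys : List A} → xs ≡ ys → Consec xs ⇒ Consec ys
  consec-cast refl c = c

  consec-++⁺ˡ : ∀ {xs ys : List A} → Consec xs ⇒ Consec (xs ++ ys)
  consec-++⁺ˡ here      = here
  consec-++⁺ˡ (there c) = there (consec-++⁺ˡ c)

  consec-++⁺ʳ : ∀ (xs : List A) {ys} → Consec ys ⇒ Consec (xs ++ ys)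
  consec-++⁺ʳ []       c = c
  consec-++⁺ʳ (x ∷ xs) c = there (consec-++⁺ʳ xs c)

  consec-++⁻ : ∀ xs {t : A} {ys u w} → Consec (xs ++ t ∷ ys) u w →
               Consec (xs ++ [ t ]) u w ⊎ Consec (t ∷ ys) u w
  consec-++⁻ []           c         = inj₂ c
  consec-++⁻ (x ∷ [])     here      = inj₁ here
  consec-++⁻ (x ∷ [])     (there c) = inj₂ c
  consec-++⁻ (x ∷ y ∷ xs) here      = inj₁ here
  consec-++⁻ (x ∷ y ∷ xs) (there c) = map⊎ there id (consec-++⁻ (y ∷ xs) c)

  consec-reverse : ∀ {xs : List A} {u w} → Consec xs u w → Consec (List.reverse xs) w u
  consec-reverse {x ∷ y ∷ zs} here rewrite unfold-reverse x (y ∷ zs) | unfold-reverse y zs =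
    consec-cast (sym (++-assoc (List.reverse zs) [ y ] [ x ])) (consec-++⁺ʳ (List.reverse zs) here)
  consec-reverse {x ∷ ys} (there c) rewrite unfold-reverse x ys = consec-++⁺ˡ (consec-reverse c)

  Unique-++⁻ : ∀ xs {ys : List A} → Unique (xs ++ ys) → Unique xs × Unique ys × Disjoint xs ys
  Unique-++⁻ []       u         = [] , u , λ ()
  Unique-++⁻ (x ∷ xs) (x∉ ∷ u) with Unique-++⁻ xs u
  ... | uxs , uys , xs#ys = All.++⁻ˡ xs x∉ ∷ uxs , uys , λ where
    (here refl , v∈ys) → All.lookup (All.++⁻ʳ xs x∉) v∈ys refl
    (there v∈xs , v∈ys) → xs#ys (v∈xs , v∈ys)

  Unique-reverse : ∀ {xs : List A} → Unique xs → Unique (List.reverse xs)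
  Unique-reverse {xs} = Unique-resp-↭ (↭-sym (↭-reverse xs))

  Unique-∷ : ∀ {x : A} {xs} → x ∉ xs → Unique xs → Unique (x ∷ xs)
  Unique-∷ x∉xs u = All.¬Any⇒All¬ _ x∉xs ∷ u

  Disjoint-++⁺ʳ : ∀ {xs ys zs : List A} → Disjoint xs ys → Disjoint xs zs → Disjoint xs (ys ++ zs)
  Disjoint-++⁺ʳ {ys = ys} xs#ys xs#zs (v∈xs , v∈ys++zs) with ∈-++⁻ ys v∈ys++zs
  ... | inj₁ v∈ys = xs#ys (v∈xs , v∈ys)
  ... | inj₂ v∈zs = xs#zs (v∈xs , v∈zs)

  length-++-∷-∷ : ∀ (xs : List A) {t ys u zs} → 2 ≤ length (xs ++ t ∷ ys ++ u ∷ zs)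
  length-++-∷-∷ []       {ys = ys} {u} {zs} = s≤s (≤-trans (s≤s z≤n) (length-++-≤ʳ (u ∷ zs) {ys}))
  length-++-∷-∷ (x ∷ xs)                    = m≤n⇒m≤1+n (length-++-∷-∷ xs)

  linked⇒consec : ∀ {R : Rel A 0ℓ} {xs} → Linked R xs → Consec xs ⇒ R
  linked⇒consec (r ∷ _)  here      = r
  linked⇒consec (_ ∷ rs) (there c) = linked⇒consec rs c
  linked⇒consec [-]      (there ())

  consec⇒linked : ∀ {R : Rel A 0ℓ} xs → Consec xs ⇒ R → Linked R xs
  consec⇒linked []           _ = []
  consec⇒linked (x ∷ [])     _ = [-]
  consec⇒linked (x ∷ y ∷ xs) f = f here ∷ consec⇒linked (y ∷ xs) (f ∘ there)

  walkEdge-cast : ∀ {xs ys : List A} → xs ≡ ys → WalkEdge xs ⇒ WalkEdge ys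
  walkEdge-cast refl e = e

  walk : A → List A → A → List A
  walk s inner t = s ∷ inner ++ [ t ]

  walk-++ : ∀ s M t N u → walk s (M ++ t ∷ N) u ≡ (s ∷ M) ++ walk t N u
  walk-++ s M t N u = cong (s ∷_) (++-assoc M (t ∷ N) [ u ])

  walkEdge-++⁻ : ∀ {s M t N u x y} → WalkEdge (walk s (M ++ t ∷ N) u) x y →
                 WalkEdge (walk s M t) x y ⊎ WalkEdge (walk t N u) x y
  walkEdge-++⁻ {s} {M} {t} {N} {u} = [ map⊎ inj₁ inj₁ ∘ split , map⊎ inj₂ inj₂ ∘ split ]′
    where
    split : ∀ {x y} → Consec (walk s (M ++ t ∷ N) u) x y → Consec (walk s M t) x y ⊎ Consec (walk t N u) x y
    split = consec-++⁻ (s ∷ M) ∘ consec-cast (walk-++ s M t N u)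

  walkEdge-++⁺ˡ : ∀ {s M t N u} → WalkEdge (walk s M t) ⇒ WalkEdge (walk s (M ++ t ∷ N) u)
  walkEdge-++⁺ˡ {s} {M} {t} {N} {u} = map⊎ embed embed
    where
    embed : Consec (walk s M t) ⇒ Consec (walk s (M ++ t ∷ N) u)
    embed = consec-cast (trans (++-assoc (s ∷ M) [ t ] (N ++ [ u ])) (sym (walk-++ s M t N u))) ∘ consec-++⁺ˡ

  walkEdge-++⁺ʳ : ∀ {s M t N u} → WalkEdge (walk t N u) ⇒ WalkEdge (walk s (M ++ t ∷ N) u)
  walkEdge-++⁺ʳ {s} {M} {t} {N} {u} = map⊎ embed embed
    where
    embed : Consec (walk t N u) ⇒ Consec (walk s (M ++ t ∷ N) u)
    embed = consec-cast (sym (walk-++ s M t N u)) ∘ consec-++⁺ʳ (s ∷ M)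

  walkEdge-reverse : ∀ {s I t} → WalkEdge (walk t (List.reverse I) s) ⇒ WalkEdge (walk s I t)
  walkEdge-reverse {s} {I} {t} = map⊎ flip flip ∘ Data.Sum.swap
    where
    reversed : walk t (List.reverse I) s ≡ List.reverse (walk s I t)
    reversed = sym (trans (unfold-reverse s (I ++ [ t ])) (cong (_++ [ s ]) (reverse-++ I [ t ])))
    flip : ∀ {x y} → Consec (walk t (List.reverse I) s) x y → Consec (walk s I t) y x
    flip = consec-cast (reverse-involutive (walk s I t)) ∘ consec-reverse ∘ consec-cast reversed

  lastOf∈ : ∀ (x : A) xs → lastOf x xs ∈ x ∷ xs
  lastOf∈ x []       = here refl
  lastOf∈ x (y ∷ xs) = there (lastOf∈ y xs)

  dropLast-++-lastOf : ∀ (r : A) rs → dropLast (r ∷ rs) ++ [ lastOf r rs ] ≡ r ∷ rs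
  dropLast-++-lastOf r []        = refl
  dropLast-++-lastOf r (r′ ∷ rs) = cong (r ∷_) (dropLast-++-lastOf r′ rs)

  walk-dropLast : ∀ (s : A) rs → s ≢ lastOf s rs → walk s (dropLast rs) (lastOf s rs) ≡ s ∷ rs
  walk-dropLast s []       s≢s = contradiction refl s≢s
  walk-dropLast s (r ∷ rs) _   = cong (s ∷_) (dropLast-++-lastOf r rs)

walkEdge⇒Adj : ∀ {n} (G : Graph n) {xs} → Linked (Graph.Adj G) xs → WalkEdge xs ⇒ Graph.Adj G
walkEdge⇒Adj G l (inj₁ c) = linked⇒consec l c
walkEdge⇒Adj G l (inj₂ c) = Graph.sym G (linked⇒consec l c)

module _ {n} {G : Graph n} where

  open Graph G using (Adj)
  open Permutation (setoid (Fin n)) using (_↭_; ↭-refl; ↭-sym; ↭-trans; ↭-reflexive)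
  open PermutationProperties (setoid (Fin n)) using (++-comm; ∈-resp-↭; xs↭ys⇒|xs|≡|ys|)

  -- The walk s, inner, t.  Its end t is left out of the vertex list, so segments glued end to
  -- end have disjoint vertex lists exactly when the glued walk repeats no vertex.
  record Segment (H : Rel (Fin n) 0ℓ) (s t : Fin n) : Set where
    field
      inner    : List (Fin n)
      edges    : WalkEdge (walk s inner t) ⇒ H
      adjacent : WalkEdge (walk s inner t) ⇒ Adj
      distinct : Unique (s ∷ inner)

    vertices : List (Fin n)
    vertices = s ∷ inner

    len : ℕ
    len = length vertices

  open Segment public

  private variable
    H H′ : Rel (Fin n) 0ℓ
    s t u : Fin n

  mapEdges : H ⇒ H′ → Segment H s t → Segment H′ s t
  mapEdges f S = record
    { inner = inner S ; edges = f ∘ edges S ; adjacent = adjacent S ; distinct = distinct S }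

  join : (S : Segment H s t) (T : Segment H t u) → Disjoint (vertices S) (vertices T) → Segment H s u
  join S T S#T = record
    { inner    = inner S ++ _ ∷ inner T
    ; edges    = [ edges S , edges T ]′ ∘ walkEdge-++⁻
    ; adjacent = [ adjacent S , adjacent T ]′ ∘ walkEdge-++⁻
    ; distinct = Unique.++⁺ (distinct S) (distinct T) S#T
    }

  len-join : (S : Segment H s t) (T : Segment H t u) (S#T : Disjoint (vertices S) (vertices T)) →
             len (join S T S#T) ≡ len S + len T
  len-join S T _ = length-++ (vertices S)

  reverse : (S : Segment H s t) → t ∉ vertices S → Segment H t s
  reverse S t∉S = record
    { inner    = List.reverse (inner S)
    ; edges    = edges S ∘ walkEdge-reverse
    ; adjacent = adjacent S ∘ walkEdge-reverse
    ; distinct = Unique-∷ (λ t∈ → t∉S (there (reverse⁻ t∈))) (Unique-reverse (tail (distinct S)))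
    }

  len-reverse : (S : Segment H s t) (t∉S : t ∉ vertices S) → len (reverse S t∉S) ≡ len S
  len-reverse S _ = cong suc (length-reverse (inner S))

  record Split (S : Segment H s u) (t : Fin n) : Set where
    field
      left        : Segment H s t
      right       : Segment H t u
      vertices-++ : vertices left ++ vertices right ≡ vertices S
      disjoint    : Disjoint (vertices left) (vertices right)

  split : (S : Segment H s u) → t ∈ inner S → Split S t
  split {t = t} S@record { inner = I ; edges = e ; adjacent = a ; distinct = d } t∈I
    with ∈-∃++ t∈I
  ... | M , N , refl = record
    { left        = record { inner = M ; edges = e ∘ walkEdge-++⁺ˡ ; adjacent = a ∘ walkEdge-++⁺ˡ
                           ; distinct = proj₁ parts }
    ; right       = record { inner = N ; edges = e ∘ walkEdge-++⁺ʳ ; adjacent = a ∘ walkEdge-++⁺ʳ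
                           ; distinct = proj₁ (proj₂ parts) }
    ; vertices-++ = refl
    ; disjoint    = proj₂ (proj₂ parts)
    }
    where parts = Unique-++⁻ (_ ∷ M) d

  rotate : (S : Segment H s s) → t ∈ vertices S → Σ (Segment H t t) λ R → vertices R ↭ vertices S
  rotate S (here refl)  = S , ↭-refl
  rotate S (there t∈S) = join right left (λ (v∈R , v∈L) → disjoint (v∈L , v∈R)) ,
    ↭-trans (++-comm (vertices right) (vertices left)) (↭-reflexive vertices-++)
    where open Split (split S t∈S)

  record Arc (S : Segment H u u) (s t : Fin n) : Set where
    field
      segment : Segment H s t
      within  : vertices segment ⊆ vertices S
      avoids  : t ∉ vertices segment

  record ArcPair (S : Segment H u u) (s t : Fin n) : Set where
    field
      arc₁ arc₂ : Arc S s t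
      len-+     : len (Arc.segment arc₁) + len (Arc.segment arc₂) ≡ len S

  arcs : (S : Segment H u u) → s ∈ vertices S → t ∈ vertices S → s ≢ t → ArcPair S s t
  arcs {s = s} {t = t} S s∈S t∈S s≢t with rotate S s∈S
  ... | R , R↭S with ∈-resp-↭ (↭-sym R↭S) t∈S
  ...   | here t≡s = contradiction (sym t≡s) s≢t
  ...   | there t∈R = record
    { arc₁  = record { segment = left ; within = left⊆S ; avoids = λ t∈L → disjoint (t∈L , here refl) }
    ; arc₂  = record { segment = reverse right s∉right ; within = within₂ ; avoids = avoids₂ }
    ; len-+ = begin
        len left + len (reverse right s∉right)    ≡⟨ cong (len left +_) (len-reverse right s∉right) ⟩
        len left + len right                       ≡⟨ length-++ (vertices left) ⟨
        length (vertices left ++ vertices right)   ≡⟨ cong length vertices-++ ⟩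
        len R                                      ≡⟨ xs↭ys⇒|xs|≡|ys| R↭S ⟩
        len S                                      ∎
    }
    where
    open Split (split R t∈R)
    open ≡-Reasoning
    onS : ∀ {v} → v ∈ vertices left ++ vertices right → v ∈ vertices S
    onS {v} = ∈-resp-↭ R↭S ∘ subst (v ∈_) vertices-++
    left⊆S : vertices left ⊆ vertices S
    left⊆S = onS ∘ ∈-++⁺ˡ
    right⊆S : vertices right ⊆ vertices S
    right⊆S = onS ∘ ∈-++⁺ʳ (vertices left)
    s∉right : s ∉ vertices right
    s∉right s∈right = disjoint (here refl , s∈right)
    within₂ : vertices (reverse right s∉right) ⊆ vertices S
    within₂ (here refl) = left⊆S (here refl)
    within₂ (there v∈) = right⊆S (there (reverse⁻ v∈))
    avoids₂ : t ∉ vertices (reverse right s∉right)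
    avoids₂ (here t≡s)  = s≢t (sym t≡s)
    avoids₂ (there t∈) = Unique.Unique[x∷xs]⇒x∉xs (distinct right) (reverse⁻ t∈)

  crossingArcs : ∀ {p} {S : Segment H u u} {S′ : Segment H′ t t} {s₁ t₁ s₂ t₂} →
    ArcPair S s₁ t₁ → ArcPair S′ s₂ t₂ → 2 ∣ p → len S % 2 ≡ 1 → len S % 4 ≡ len S′ % 4 →
    Σ (Arc S s₁ t₁ × Arc S′ s₂ t₂) λ (K , J) → 4 ∣ p + (len (Arc.segment K) + len (Arc.segment J))
  crossingArcs A B 2∣p odd same =
    [ (A.arc₁ , B.arc₁) ,_ , [ (A.arc₁ , B.arc₂) ,_ , [ (A.arc₂ , B.arc₁) ,_ , (A.arc₂ , B.arc₂) ,_ ]′ ]′ ]′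
      (crossingSum {α₁ = len (Arc.segment A.arc₁)} {len (Arc.segment A.arc₂)}
                   {len (Arc.segment B.arc₁)} {len (Arc.segment B.arc₂)} 2∣p (trans (cong (_% 2) A.len-+) odd)
        (trans (cong (_% 4) A.len-+) (trans same (cong (_% 4) (sym B.len-+)))))
    where
    module A = ArcPair A
    module B = ArcPair B

  cycleSegment : (C : Cycle G) → Segment (Cycle.Edge C) (Cycle.first C) (Cycle.first C)
  cycleSegment C = record
    { inner = Cycle.rest C ; edges = id ; adjacent = walkEdge⇒Adj G (Cycle.adjacent C)
    ; distinct = Cycle.distinct C }

  close : (S : Segment H s s) → 2 ≤ length (inner S) → Σ (Cycle G) λ D → Cycle.len D ≡ len S × CycleIn D H
  close S long = record
    { first = _ ; rest = inner S ; long = long ; distinct = distinct S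
    ; adjacent = consec⇒linked _ (adjacent S ∘ inj₁) } , refl , λ _ _ → edges S

  close₃ : (S : Segment H s t) (T : Segment H t u) (U : Segment H u s) →
           Disjoint (vertices S) (vertices T) → Disjoint (vertices S) (vertices U) →
           Disjoint (vertices T) (vertices U) →
           Σ (Cycle G) λ D → Cycle.len D ≡ len S + (len T + len U) × CycleIn D H
  close₃ S T U S#T S#U T#U =
    let D , len-D , D⊆H = close (join S TU S#TU) (length-++-∷-∷ (inner S))
    in D , trans len-D (trans (len-join S TU S#TU) (cong (len S +_) (len-join T U T#U))) , D⊆H
    where
    TU = join T U T#U
    S#TU = Disjoint-++⁺ʳ S#T S#U

  record Leg (W : List (Fin n)) (P : Path G) (s t : Fin n) : Set where
    field
      segment : Segment (Path.Edge P) s t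
      len≡    : len segment ≡ Path.len P
      within  : vertices segment ⊆ Path.verts P
      outside : ∀ {v} → v ∈ vertices segment → v ≡ s ⊎ v ∉ W

    disjoint : ∀ {xs} → xs ⊆ W → s ∉ xs → Disjoint (vertices segment) xs
    disjoint xs⊆W s∉xs (v∈segment , v∈xs) with outside v∈segment
    ... | inj₁ refl = s∉xs v∈xs
    ... | inj₂ v∉W  = v∉W (xs⊆W v∈xs)

  module _ {C₁ C₂ : Cycle G} {P : Path G} (P-from-to : PathFromTo C₁ C₂ P)
           (nontrivial : Path.first P ≢ Path.lastV P) where

    private
      W = Cycle.verts C₁ ++ Cycle.verts C₂
      I = Path.internal P

      shape : walk (Path.first P) I (Path.lastV P) ≡ Path.verts P
      shape = walk-dropLast (Path.first P) (Path.rest P) nontrivial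

      parts = Unique-++⁻ (Path.first P ∷ I) (subst Unique (sym shape) (Path.distinct P))

      onPath : walk (Path.first P) I (Path.lastV P) ⊆ Path.verts P
      onPath {v} = subst (v ∈_) shape

      internal-outside : ∀ {v} → v ∈ I → v ∉ W
      internal-outside v∈I v∈W with All.lookup (proj₂ (proj₂ P-from-to)) v∈I
      ... | v∉C₁ , v∉C₂ = [ v∉C₁ , v∉C₂ ]′ (∈-++⁻ (Cycle.verts C₁) v∈W)

      forward : Segment (Path.Edge P) (Path.first P) (Path.lastV P)
      forward = record
        { inner    = I
        ; edges    = walkEdge-cast shape
        ; adjacent = walkEdge⇒Adj G (Path.adjacent P) ∘ walkEdge-cast shape
        ; distinct = proj₁ parts
        }

      len-forward : len forward ≡ Path.len P
      len-forward = suc-injective (begin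
        suc (len forward)              ≡⟨ +-comm 1 (len forward) ⟩
        len forward + 1                ≡⟨ length-++ (vertices forward) ⟨
        length (vertices forward ++ [ Path.lastV P ]) ≡⟨ cong length shape ⟩
        suc (Path.len P)               ∎)
        where open ≡-Reasoning

      lastV∉forward : Path.lastV P ∉ vertices forward
      lastV∉forward lastV∈ = proj₂ (proj₂ parts) (lastV∈ , here refl)

    forwardLeg : Leg W P (Path.first P) (Path.lastV P)
    forwardLeg = record
      { segment = forward
      ; len≡    = len-forward
      ; within  = onPath ∘ ∈-++⁺ˡ
      ; outside = λ where
          (here v≡first) → inj₁ v≡first
          (there v∈I)    → inj₂ (internal-outside v∈I)
      }

    backwardLeg : Leg W P (Path.lastV P) (Path.first P)
    backwardLeg = record
      { segment = reverse forward lastV∉forward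
      ; len≡    = trans (len-reverse forward lastV∉forward) len-forward
      ; within  = λ where
          (here refl) → onPath (∈-++⁺ʳ (vertices forward) (here refl))
          (there v∈)  → onPath (there (∈-++⁺ˡ {xs = I} (reverse⁻ v∈)))
      ; outside = λ where
          (here v≡lastV) → inj₁ v≡lastV
          (there v∈)     → inj₂ (internal-outside (reverse⁻ v∈))
      }

  Around : Cycle G → Cycle G → Rel (Fin n) 0ℓ → Rel (Fin n) 0ℓ
  Around C₁ C₂ E u w = Cycle.Edge C₁ u w ⊎ Cycle.Edge C₂ u w ⊎ E u w

  cycleThroughTwoPaths : ∀ {E} (C₁ C₂ : Cycle G) (Q₁ Q₂ : Path G) → Path.Edge Q₁ ⇒ E → Path.Edge Q₂ ⇒ E →
    Cycle.len C₁ % 2 ≡ 1 → Cycle.len C₁ % 4 ≡ Cycle.len C₂ % 4 →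
    PathFromTo C₁ C₂ Q₁ → PathFromTo C₁ C₂ Q₂ →
    VDisjoint (Path.verts Q₁) (Path.verts Q₂) → VDisjoint (Cycle.verts C₁) (Cycle.verts C₂) →
    2 ∣ Path.len Q₁ + Path.len Q₂ →
    Σ (Cycle G) λ D → 4 ∣ Cycle.len D × CycleIn D (Around C₁ C₂ E)
  cycleThroughTwoPaths {E} C₁ C₂ Q₁ Q₂ Q₁⊆E Q₂⊆E odd same F₁ F₂ Q₁#Q₂ C₁#C₂ even =
    let (K , J) , 4∣ = crossingArcs (arcs (cycleSegment C₁) a₂∈C₁ a₁∈C₁ a₂≢a₁)
                                    (arcs (cycleSegment C₂) b₁∈C₂ b₂∈C₂ b₁≢b₂) even odd same
    in assemble K J 4∣
    where
    a₁ = Path.first Q₁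
    b₁ = Path.lastV Q₁
    a₂ = Path.first Q₂
    b₂ = Path.lastV Q₂
    a₁∈C₁ = proj₁ F₁
    a₂∈C₁ = proj₁ F₂
    b₁∈C₂ = proj₁ (proj₂ F₁)
    b₂∈C₂ = proj₁ (proj₂ F₂)

    W = Cycle.verts C₁ ++ Cycle.verts C₂
    C₁⊆W : Cycle.verts C₁ ⊆ W
    C₁⊆W = ∈-++⁺ˡ
    C₂⊆W : Cycle.verts C₂ ⊆ W
    C₂⊆W = ∈-++⁺ʳ (Cycle.verts C₁)

    a₂≢a₁ : a₂ ≢ a₁
    a₂≢a₁ a₂≡a₁ = Q₁#Q₂ a₁ (here refl) (here (sym a₂≡a₁))
    b₁≢b₂ : b₁ ≢ b₂
    b₁≢b₂ b₁≡b₂ = Q₁#Q₂ b₁ (lastOf∈ a₁ (Path.rest Q₁)) (subst (_∈ Path.verts Q₂) (sym b₁≡b₂) (lastOf∈ a₂ (Path.rest Q₂)))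
    nontrivial : ∀ {Q : Path G} → PathFromTo C₁ C₂ Q → Path.first Q ≢ Path.lastV Q
    nontrivial (a∈C₁ , b∈C₂ , _) a≡b = C₁#C₂ _ a∈C₁ (subst (_∈ Cycle.verts C₂) (sym a≡b) b∈C₂)

    L₁ : Leg W Q₁ a₁ b₁
    L₁ = forwardLeg {C₁} {C₂} {Q₁} F₁ (nontrivial {Q₁} F₁)
    L₂ : Leg W Q₂ b₂ a₂
    L₂ = backwardLeg {C₁} {C₂} {Q₂} F₂ (nontrivial {Q₂} F₂)
    module L₁ = Leg L₁
    module L₂ = Leg L₂

    assemble : (K : Arc (cycleSegment C₁) a₂ a₁) (J : Arc (cycleSegment C₂) b₁ b₂) →
      4 ∣ (Path.len Q₁ + Path.len Q₂) + (len (Arc.segment K) + len (Arc.segment J)) →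
      Σ (Cycle G) λ D → 4 ∣ Cycle.len D × CycleIn D (Around C₁ C₂ E)
    assemble K J 4∣ =
      let D , len-D , D⊆H = close₃ S₁ S₂ S₃ L₁#J (Disjoint-++⁺ʳ L₁#L₂ L₁#K) (Disjoint-++⁺ʳ J#L₂ J#K)
      in D , subst (4 ∣_) (sym (trans len-D len-S)) 4∣ , D⊆H
      where
      module K = Arc K
      module J = Arc J
      L₂#K : Disjoint (vertices L₂.segment) (vertices K.segment)
      L₂#K = L₂.disjoint (C₁⊆W ∘ K.within) (λ b₂∈K → C₁#C₂ b₂ (K.within b₂∈K) b₂∈C₂)
      L₁#J : Disjoint (vertices L₁.segment) (vertices J.segment)
      L₁#J = L₁.disjoint (C₂⊆W ∘ J.within) (λ a₁∈J → C₁#C₂ a₁ a₁∈C₁ (J.within a₁∈J))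
      L₁#L₂ : Disjoint (vertices L₁.segment) (vertices L₂.segment)
      L₁#L₂ (v∈L₁ , v∈L₂) = Q₁#Q₂ _ (L₁.within v∈L₁) (L₂.within v∈L₂)
      L₁#K : Disjoint (vertices L₁.segment) (vertices K.segment)
      L₁#K = L₁.disjoint (C₁⊆W ∘ K.within) K.avoids
      J#L₂ : Disjoint (vertices J.segment) (vertices L₂.segment)
      J#L₂ (v∈J , v∈L₂) = L₂.disjoint (C₂⊆W ∘ J.within) J.avoids (v∈L₂ , v∈J)
      J#K : Disjoint (vertices J.segment) (vertices K.segment)
      J#K (v∈J , v∈K) = C₁#C₂ _ (K.within v∈K) (J.within v∈J)
      S₁ : Segment (Around C₁ C₂ E) a₁ b₁
      S₁ = mapEdges (inj₂ ∘ inj₂ ∘ Q₁⊆E) L₁.segment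
      S₂ : Segment (Around C₁ C₂ E) b₁ b₂
      S₂ = mapEdges (inj₂ ∘ inj₁) J.segment
      L₂′ : Segment (Around C₁ C₂ E) b₂ a₂
      L₂′ = mapEdges (inj₂ ∘ inj₂ ∘ Q₂⊆E) L₂.segment
      K′ : Segment (Around C₁ C₂ E) a₂ a₁
      K′ = mapEdges inj₁ K.segment
      S₃ : Segment (Around C₁ C₂ E) b₂ a₁
      S₃ = join L₂′ K′ L₂#K
      len-S : len S₁ + (len S₂ + len S₃) ≡ (Path.len Q₁ + Path.len Q₂) + (len K.segment + len J.segment)
      len-S = begin
        len S₁ + (len S₂ + len S₃)
          ≡⟨ cong₂ (λ q₁ l → q₁ + (len S₂ + l)) L₁.len≡ (trans (len-join L₂′ K′ L₂#K) (cong (_+ len K.segment) L₂.len≡)) ⟩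
        Path.len Q₁ + (len J.segment + (Path.len Q₂ + len K.segment))
          ≡⟨ rearrange (Path.len Q₁) (Path.len Q₂) (len K.segment) (len J.segment) ⟩
        (Path.len Q₁ + Path.len Q₂) + (len K.segment + len J.segment) ∎
        where
        open ≡-Reasoning
        rearrange : ∀ q₁ q₂ k j → q₁ + (j + (q₂ + k)) ≡ (q₁ + q₂) + (k + j)
        rearrange = solve-∀

  cycleThroughCommonVertex : ∀ (C₁ C₂ : Cycle G) (Q : Path G) →
    Cycle.len C₁ % 2 ≡ 1 → Cycle.len C₁ % 4 ≡ Cycle.len C₂ % 4 → PathFromTo C₁ C₂ Q → (x : Fin n) →
    x ∈ Cycle.verts C₁ → x ∈ Cycle.verts C₂ → (∀ v → v ∈ Cycle.verts C₁ → v ∈ Cycle.verts C₂ → v ≡ x) →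
    2 ∣ Path.len Q → x ∉ Path.verts Q →
    Σ (Cycle G) λ D → 4 ∣ Cycle.len D × CycleIn D (Around C₁ C₂ (Path.Edge Q))
  cycleThroughCommonVertex C₁ C₂ Q odd same F x x∈C₁ x∈C₂ only-x even x∉Q =
    let (K , M) , 4∣ = crossingArcs (arcs (cycleSegment C₁) x∈C₁ a∈C₁ (λ x≡a → a≢x (sym x≡a)))
                                    (arcs (cycleSegment C₂) b∈C₂ x∈C₂ b≢x) even odd same
    in assemble K M 4∣
    where
    a = Path.first Q
    b = Path.lastV Q
    a∈C₁ = proj₁ F
    b∈C₂ = proj₁ (proj₂ F)

    a≢x : a ≢ x
    a≢x a≡x = x∉Q (subst (_∈ Path.verts Q) a≡x (here refl))
    b≢x : b ≢ x
    b≢x b≡x = x∉Q (subst (_∈ Path.verts Q) b≡x (lastOf∈ a (Path.rest Q)))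
    a∉C₂ : a ∉ Cycle.verts C₂
    a∉C₂ = a≢x ∘ only-x a a∈C₁

    L : Leg (Cycle.verts C₁ ++ Cycle.verts C₂) Q a b
    L = forwardLeg {C₁} {C₂} {Q} F (λ a≡b → a∉C₂ (subst (_∈ Cycle.verts C₂) (sym a≡b) b∈C₂))
    module L = Leg L

    assemble : (K : Arc (cycleSegment C₁) x a) (M : Arc (cycleSegment C₂) b x) →
      4 ∣ Path.len Q + (len (Arc.segment K) + len (Arc.segment M)) →
      Σ (Cycle G) λ D → 4 ∣ Cycle.len D × CycleIn D (Around C₁ C₂ (Path.Edge Q))
    assemble K M 4∣ =
      let D , len-D , D⊆H = close₃ K′ L′ M′ K#L K#M L#M
      in D , subst (4 ∣_) (sym (trans len-D len-S)) 4∣ , D⊆H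
      where
      module K = Arc K
      module M = Arc M
      K′ : Segment (Around C₁ C₂ (Path.Edge Q)) x a
      K′ = mapEdges inj₁ K.segment
      L′ : Segment (Around C₁ C₂ (Path.Edge Q)) a b
      L′ = mapEdges (inj₂ ∘ inj₂) L.segment
      M′ : Segment (Around C₁ C₂ (Path.Edge Q)) b x
      M′ = mapEdges (inj₂ ∘ inj₁) M.segment
      K#L : Disjoint (vertices K.segment) (vertices L.segment)
      K#L (v∈K , v∈L) = L.disjoint (∈-++⁺ˡ ∘ K.within) K.avoids (v∈L , v∈K)
      K#M : Disjoint (vertices K.segment) (vertices M.segment)
      K#M (v∈K , v∈M) = M.avoids (subst (_∈ vertices M.segment) (only-x _ (K.within v∈K) (M.within v∈M)) v∈M)
      L#M : Disjoint (vertices L.segment) (vertices M.segment)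
      L#M = L.disjoint (∈-++⁺ʳ (Cycle.verts C₁) ∘ M.within) (a∉C₂ ∘ M.within)
      len-S : len K′ + (len L′ + len M′) ≡ Path.len Q + (len K.segment + len M.segment)
      len-S = begin
        len K.segment + (len L.segment + len M.segment) ≡⟨ cong (λ q → len K.segment + (q + len M.segment)) L.len≡ ⟩
        len K.segment + (Path.len Q + len M.segment)    ≡⟨ rearrange (Path.len Q) (len K.segment) (len M.segment) ⟩
        Path.len Q + (len K.segment + len M.segment)    ∎
        where
        open ≡-Reasoning
        rearrange : ∀ q k m → k + (q + m) ≡ q + (k + m)
        rearrange = solve-∀

lemma6 : ∀ {n} (G : Graph n) (C₁ C₂ : Cycle G) (P₁ P₂ P₃ : Path G) →
    Cycle.len C₁ % 2 ≡ 1 → Cycle.len C₂ % 2 ≡ 1 →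
    Cycle.len C₁ % 4 ≡ Cycle.len C₂ % 4 →
    PathFromTo C₁ C₂ P₁ → PathFromTo C₁ C₂ P₂ → PathFromTo C₁ C₂ P₃ →
    VDisjoint (Path.verts P₁) (Path.verts P₂) →
    VDisjoint (Path.verts P₁) (Path.verts P₃) →
    VDisjoint (Path.verts P₂) (Path.verts P₃) →
    -- (1)
    (VDisjoint (Cycle.verts C₁) (Cycle.verts C₂) →
     2 ∣ (Path.len P₁ + Path.len P₂) →
     Σ (Cycle G) λ D → 4 ∣ Cycle.len D ×
       CycleIn D (λ u w → Cycle.Edge C₁ u w ⊎ Cycle.Edge C₂ u w ⊎
                          Path.Edge P₁ u w ⊎ Path.Edge P₂ u w))
    ×
    -- (2)
    ((x : Fin n) → x ∈ Cycle.verts C₁ → x ∈ Cycle.verts C₂ →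
     (∀ v → v ∈ Cycle.verts C₁ → v ∈ Cycle.verts C₂ → v ≡ x) →
     2 ∣ Path.len P₁ → x ∉ Path.verts P₁ →
     Σ (Cycle G) λ D → 4 ∣ Cycle.len D ×
       CycleIn D (λ u w → Cycle.Edge C₁ u w ⊎ Cycle.Edge C₂ u w ⊎
                          Path.Edge P₁ u w))
    ×
    -- (3)
    (VDisjoint (Cycle.verts C₁) (Cycle.verts C₂) →
     Σ (Cycle G) λ D → 4 ∣ Cycle.len D ×
       CycleIn D (λ u w → Cycle.Edge C₁ u w ⊎ Cycle.Edge C₂ u w ⊎
                          Path.Edge P₁ u w ⊎ Path.Edge P₂ u w ⊎
                          Path.Edge P₃ u w))
-- |C₂| is odd because |C₁| is and |C₁| ≡ |C₂| (mod 4).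
lemma6 G C₁ C₂ P₁ P₂ P₃ odd₁ _ same F₁ F₂ F₃ P₁#P₂ P₁#P₃ P₂#P₃ =
  cycleThroughTwoPaths C₁ C₂ P₁ P₂ inj₁ inj₂ odd₁ same F₁ F₂ P₁#P₂ ,
  cycleThroughCommonVertex C₁ C₂ P₁ odd₁ same F₁ ,
  λ C₁#C₂ → [ cycleThroughTwoPaths C₁ C₂ P₁ P₂ inj₁ (inj₂ ∘ inj₁) odd₁ same F₁ F₂ P₁#P₂ C₁#C₂
            , [ cycleThroughTwoPaths C₁ C₂ P₁ P₃ inj₁ (inj₂ ∘ inj₂) odd₁ same F₁ F₃ P₁#P₃ C₁#C₂
              , cycleThroughTwoPaths C₁ C₂ P₂ P₃ (inj₂ ∘ inj₁) (inj₂ ∘ inj₂) odd₁ same F₂ F₃ P₂#P₃ C₁#C₂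
              ]′ ]′
            (evenPairSum (Path.len P₁) (Path.len P₂) (Path.len P₃))
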